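{- Let $f:\{0,1\}^n\to\{0,1\}$ have $\mathrm{GF}(2)$ polynomial representation $f(x_1,\ldots,x_n)=\sum_{i=1}^m x_{S_i}$, where $S_1,\ldots,S_m$ are distinct subsets of $[n]$ and $x_S=\prod_{j\in S}x_j$. For $T\subseteq[n]$ define $$w_f(T)=\sum_{M\subseteq[m]:\ \bigcup_{i\in M}S_i=T}\frac{(-2)^{|M|}}{2^{|T|}}.$$ Then for every $S\subseteq[n]$, the Fourier coefficient of $f^{\pm}=(-1)^f$ at $S$ is $$\widehat{f^{\pm}}(S)=(-1)^{|S|}\sum_{T\supseteq S}w_f(T),$$ where the sum ranges over all $T$ with $S\subseteq T\subseteq[n]$.
   Context: For $h:\{0,1\}^n\to\mathbb{R}$ and $S\subseteq[n]$, $\hat h(S)=2^{ -n}\sum_{x\in\{0,1\}^n}h(x)(-1)^{\sum_{i\in S}x_i}$. The function $f^{\pm}=1-2f$ takes values in $\{ -1,1\}$. In the sum defining $w_f$, $M=\emptyset$ is allowed (its union is $\emptyset$). Equivalently $w_f(T)=2^{ -|T|}\sum_k(-2)^kN_k(T)$, where $N_k(T)$ is the number of $k$-element subfamilies of $\{S_1,\ldots,S_m\}$ whose union is $T$. -}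

module Defs where

open import Data.Bool using (Bool; true; false; _∧_; _xor_; if_then_else_; not)
open import Data.Nat using (ℕ; zero; suc)
open import Data.Fin using (Fin)
open import Data.Vec using (Vec; []; _∷_; lookup)
open import Data.List using (List; []; _∷_; map; foldr; _++_; allFin; filter)
open import Data.Rational using (ℚ; 0ℚ; 1ℚ; _+_; _*_; _-_; -_; ½)
open import Data.Fin.Subset using (Subset; _∪_; _⊆_; ∣_∣)
open import Data.Fin.Subset.Properties using (_⊆?_)
open import Data.Vec.Properties using (≡-dec)
import Data.Bool.Properties as BoolP
open import Relation.Nullary.Decidable using (⌊_⌋)

pow : ℚ → ℕ → ℚ
pow q zero    = 1ℚ
pow q (suc k) = q * pow q k

sumℚ : List ℚ → ℚ
sumℚ = foldr _+_ 0ℚ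

-- all vectors in {0,1}^n (true = 1); also serves as all subsets of [n]
allVecs : (n : ℕ) → List (Vec Bool n)
allVecs zero    = [] ∷ []
allVecs (suc n) = map (false ∷_) (allVecs n) ++ map (true ∷_) (allVecs n)

allSubsets : (n : ℕ) → List (Subset n)
allSubsets = allVecs

monomial : {n : ℕ} → Subset n → Vec Bool n → Bool
monomial {n} S x = foldr (λ j b → (not (lookup S j) Data.Bool.∨ lookup x j) ∧ b) true (allFin n)

polyGF2 : {n m : ℕ} → (Fin m → Subset n) → Vec Bool n → Bool
polyGF2 {n} {m} S x = foldr (λ i b → monomial (S i) x xor b) false (allFin m)

toℚ : Bool → ℚ
toℚ true  = 1ℚ
toℚ false = 0ℚ

pm : {n : ℕ} → (Vec Bool n → Bool) → Vec Bool n → ℚ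
pm f x = 1ℚ - (toℚ true + toℚ true) * toℚ (f x)

dotCount : {n : ℕ} → Subset n → Vec Bool n → ℕ
dotCount {n} S x = foldr (λ j k → if lookup S j ∧ lookup x j then suc k else k) zero (allFin n)

fourier : {n : ℕ} → (Vec Bool n → ℚ) → Subset n → ℚ
fourier {n} h S = pow ½ n * sumℚ (map (λ x → h x * pow (- 1ℚ) (dotCount S x)) (allVecs n))

unionOf : {n m : ℕ} → (Fin m → Subset n) → Subset m → Subset n
unionOf {n} {m} S M = foldr (λ i U → if lookup M i then S i ∪ U else U) Data.Fin.Subset.⊥ (allFin m)

wf : {n m : ℕ} → (Fin m → Subset n) → Subset n → ℚ
wf {n} {m} S T =
  sumℚ (map (λ M → if ⌊ ≡-dec BoolP._≟_ (unionOf S M) T ⌋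
                     then pow (- (1ℚ + 1ℚ)) ∣ M ∣ * pow ½ ∣ T ∣
                     else 0ℚ)
            (allSubsets m))

sumSupersets : {n m : ℕ} → (Fin m → Subset n) → Subset n → ℚ
sumSupersets {n} S U =
  sumℚ (map (λ T → if ⌊ U ⊆? T ⌋ then wf S T else 0ℚ) (allSubsets n))

module Submission where

-- Writing f = x_{S_1} ⊕ … ⊕ x_{S_m}, the sign function turns xor into a
-- product, and 1 - 2b is affine in a bit b, so
--     f^± = ∏_i (1 - 2 x_{S_i}) = Σ_{M ⊆ [m]} (-2)^{|M|} x_{⋃_{i∈M} S_i},
-- using x_A x_B = x_{A ∪ B}.  The Fourier transform is linear, and a single
-- monomial has the explicit transform
--     x̂_T(U) = [U ⊆ T] (-1)^{|U|} 2^{-|T|},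
-- proved coordinate by coordinate since both sides factor over coordinates.
-- Hence f̂^±(U) = Σ_M (-2)^{|M|} x̂_{⋃M}(U).  On the other side, regrouping
-- Σ_{T ⊇ U} w_f(T) by the family M (each M contributes to exactly one T,
-- namely its union) yields the same sum after multiplying by (-1)^{|U|}.

open import Defs
open import Data.Nat using (ℕ)
open import Data.Fin using (Fin)
open import Data.Fin.Subset using (Subset; ∣_∣)
open import Data.Rational using (ℚ; 1ℚ; _*_; -_)
open import Function.Definitions using (Injective)
open import Relation.Binary.PropositionalEquality using (_≡_)

open import Data.Bool using (Bool; true; false; _∧_; _∨_; _xor_; if_then_else_; not)
import Data.Bool.Properties as BoolP
open import Data.Nat using (zero; suc)
open import Data.Fin using () renaming (zero to fz; suc to fs)
open import Data.Fin.Subset using (_∪_; ⊥)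
open import Data.Fin.Subset.Properties using (_⊆?_)
open import Data.Vec using (Vec; []; _∷_; lookup)
open import Data.Vec.Properties using (≡-dec)
open import Data.List using (List; []; _∷_; map; foldr; _++_; allFin)
open import Data.List.Properties using (foldr-map; map-tabulate)
open import Data.Rational using (0ℚ; _+_; _-_; ½)
open import Data.Rational.Properties
  using (+-identityˡ; +-identityʳ; +-assoc; *-zeroˡ; *-zeroʳ; *-identityˡ; *-identityʳ;
         *-distribˡ-+; *-distribʳ-+; *-comm; *-assoc)
open import Data.Rational.Solver using (module +-*-Solver)
open +-*-Solver using (solve; _:+_; _:*_; _:=_)
open import Function using (_∘_; id)
open import Relation.Nullary.Decidable using (⌊_⌋; isYes≗does; ⌊⌋-map′)
open import Relation.Binary.PropositionalEquality using (refl; sym; trans; cong; cong₂; module ≡-Reasoning)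

Σ : {A : Set} → List A → (A → ℚ) → ℚ
Σ xs F = sumℚ (map F xs)

Σ-cong : {A : Set} (xs : List A) {F G : A → ℚ} → (∀ x → F x ≡ G x) → Σ xs F ≡ Σ xs G
Σ-cong []       eq = refl
Σ-cong (x ∷ xs) eq = cong₂ _+_ (eq x) (Σ-cong xs eq)

Σ-zero : {A : Set} (xs : List A) → Σ xs (λ _ → 0ℚ) ≡ 0ℚ
Σ-zero []       = refl
Σ-zero (x ∷ xs) = trans (+-identityˡ _) (Σ-zero xs)

Σ-++ : {A : Set} (xs ys : List A) (F : A → ℚ) → Σ (xs ++ ys) F ≡ Σ xs F + Σ ys F
Σ-++ []       ys F = sym (+-identityˡ _)
Σ-++ (x ∷ xs) ys F = trans (cong (F x +_) (Σ-++ xs ys F)) (sym (+-assoc (F x) _ _))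

Σ-map : {A B : Set} (xs : List A) (g : A → B) (F : B → ℚ) → Σ (map g xs) F ≡ Σ xs (F ∘ g)
Σ-map []       g F = refl
Σ-map (x ∷ xs) g F = cong (F (g x) +_) (Σ-map xs g F)

Σ-scale : {A : Set} (xs : List A) (a : ℚ) (F : A → ℚ) → Σ xs (λ x → a * F x) ≡ a * Σ xs F
Σ-scale []       a F = sym (*-zeroʳ a)
Σ-scale (x ∷ xs) a F = trans (cong (a * F x +_) (Σ-scale xs a F)) (sym (*-distribˡ-+ a (F x) _))

Σ-scaleʳ : {A : Set} (xs : List A) (F : A → ℚ) (a : ℚ) → Σ xs F * a ≡ Σ xs (λ x → F x * a)
Σ-scaleʳ xs F a = trans (*-comm (Σ xs F) a)
  (trans (sym (Σ-scale xs a F)) (Σ-cong xs (λ x → *-comm a (F x))))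

Σ-add : {A : Set} (xs : List A) (F G : A → ℚ) → Σ xs (λ x → F x + G x) ≡ Σ xs F + Σ xs G
Σ-add []       F G = refl
Σ-add (x ∷ xs) F G = trans (cong (F x + G x +_) (Σ-add xs F G))
  (solve 4 (λ a b c d → (a :+ b) :+ (c :+ d) := (a :+ c) :+ (b :+ d)) refl
           (F x) (G x) (Σ xs F) (Σ xs G))

Σ-swap : {A B : Set} (xs : List A) (ys : List B) (F : A → B → ℚ) →
  Σ xs (λ x → Σ ys (F x)) ≡ Σ ys (λ y → Σ xs (λ x → F x y))
Σ-swap []       ys F = sym (Σ-zero ys)
Σ-swap (x ∷ xs) ys F = trans (cong (Σ ys (F x) +_) (Σ-swap xs ys F))
  (sym (Σ-add ys (F x) (λ y → Σ xs (λ x′ → F x′ y))))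

if-Σ : {A : Set} (xs : List A) (b : Bool) (F : A → ℚ) →
  (if b then Σ xs F else 0ℚ) ≡ Σ xs (λ x → if b then F x else 0ℚ)
if-Σ xs false F = sym (Σ-zero xs)
if-Σ xs true  F = refl

Σ-allVecs : (n : ℕ) (F : Vec Bool (suc n) → ℚ) →
  Σ (allVecs (suc n)) F ≡ Σ (allVecs n) (λ x → F (false ∷ x)) + Σ (allVecs n) (λ x → F (true ∷ x))
Σ-allVecs n F = trans (Σ-++ (map (false ∷_) (allVecs n)) _ F)
  (cong₂ _+_ (Σ-map (allVecs n) (false ∷_) F) (Σ-map (allVecs n) (true ∷_) F))

foldr-allFin-suc : {B : Set} {n : ℕ} (g : Fin (suc n) → B → B) (e : B) →
  foldr g e (allFin (suc n)) ≡ g fz (foldr (g ∘ fs) e (allFin n))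
foldr-allFin-suc {n = n} g e = cong (g fz)
  (trans (cong (foldr g e) (sym (map-tabulate id fs))) (foldr-map g fs e (allFin n)))

monomial-cons : {n : ℕ} (s : Bool) (S : Subset n) (c : Bool) (x : Vec Bool n) →
  monomial (s ∷ S) (c ∷ x) ≡ (not s ∨ c) ∧ monomial S x
monomial-cons {n} s S c x =
  foldr-allFin-suc {n = n} (λ j b → (not (lookup (s ∷ S) j) ∨ lookup (c ∷ x) j) ∧ b) true

dotCount-cons : {n : ℕ} (u : Bool) (U : Subset n) (c : Bool) (x : Vec Bool n) →
  dotCount (u ∷ U) (c ∷ x) ≡ (if u ∧ c then suc (dotCount U x) else dotCount U x)
dotCount-cons {n} u U c x =
  foldr-allFin-suc {n = n} (λ j k → if lookup (u ∷ U) j ∧ lookup (c ∷ x) j then suc k else k) zero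

polyGF2-cons : {n m : ℕ} (S : Fin (suc m) → Subset n) (x : Vec Bool n) →
  polyGF2 S x ≡ monomial (S fz) x xor polyGF2 (S ∘ fs) x
polyGF2-cons {m = m} S x =
  foldr-allFin-suc {n = m} (λ i b → monomial (S i) x xor b) false

unionOf-cons : {n m : ℕ} (S : Fin (suc m) → Subset n) (b : Bool) (M : Subset m) →
  unionOf S (b ∷ M) ≡ (if b then S fz ∪ unionOf (S ∘ fs) M else unionOf (S ∘ fs) M)
unionOf-cons {m = m} S b M =
  foldr-allFin-suc {n = m} (λ i U → if lookup (b ∷ M) i then S i ∪ U else U) ⊥

sign : Bool → ℚ
sign b = 1ℚ - (toℚ true + toℚ true) * toℚ b

sign-xor : (a b : Bool) → sign (a xor b) ≡ sign a * sign b
sign-xor false false = refl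
sign-xor false true  = refl
sign-xor true  false = refl
sign-xor true  true  = refl

sign-affine : (a : Bool) → sign a ≡ 1ℚ + (- (1ℚ + 1ℚ)) * toℚ a
sign-affine false = refl
sign-affine true  = refl

toℚ-∧ : (a b : Bool) → toℚ (a ∧ b) ≡ toℚ a * toℚ b
toℚ-∧ false b = sym (*-zeroˡ (toℚ b))
toℚ-∧ true  b = sym (*-identityˡ (toℚ b))

monomial-⊥ : {n : ℕ} (x : Vec Bool n) → monomial ⊥ x ≡ true
monomial-⊥ []      = refl
monomial-⊥ (c ∷ x) = trans (monomial-cons false ⊥ c x) (monomial-⊥ x)

monomial-∪ : {n : ℕ} (A B : Subset n) (x : Vec Bool n) →
  monomial (A ∪ B) x ≡ monomial A x ∧ monomial B x
monomial-∪ []      []      []      = refl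
monomial-∪ (a ∷ A) (b ∷ B) (c ∷ x)
  rewrite monomial-cons (a ∨ b) (A ∪ B) c x | monomial-cons a A c x
        | monomial-cons b B c x | monomial-∪ A B x
  = coordinate a b c (monomial A x) (monomial B x)
  where
  coordinate : ∀ a b c p q → (not (a ∨ b) ∨ c) ∧ (p ∧ q) ≡ ((not a ∨ c) ∧ p) ∧ ((not b ∨ c) ∧ q)
  coordinate false false c     p     q = refl
  coordinate false true  false false q = refl
  coordinate false true  false true  q = refl
  coordinate false true  true  p     q = refl
  coordinate true  b     false p     q = refl
  coordinate true  false true  p     q = refl
  coordinate true  true  true  p     q = refl

weight : {m : ℕ} → Subset m → ℚ
weight M = pow (- (1ℚ + 1ℚ)) ∣ M ∣

-- f^± = Σ_{M ⊆ [m]} (-2)^{|M|} x_{⋃_{i∈M} S_i}, by induction on m: peeling off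
-- S_1 multiplies the expansion for S_2, …, S_m by 1 + (-2) x_{S_1}.
sign-expansion : {n : ℕ} (m : ℕ) (S : Fin m → Subset n) (x : Vec Bool n) →
  pm (polyGF2 S) x ≡ Σ (allVecs m) (λ M → weight M * toℚ (monomial (unionOf S M) x))
sign-expansion zero    S x rewrite monomial-⊥ x = refl
sign-expansion (suc m) S x = begin
  sign (polyGF2 S x)                      ≡⟨ cong sign (polyGF2-cons S x) ⟩
  sign (a xor rest)                       ≡⟨ sign-xor a rest ⟩
  sign a * sign rest                      ≡⟨ cong₂ _*_ (sign-affine a) (sign-expansion m (S ∘ fs) x) ⟩
  (1ℚ + k * toℚ a) * R                    ≡⟨ *-distribʳ-+ R 1ℚ (k * toℚ a) ⟩
  1ℚ * R + k * toℚ a * R                  ≡⟨ cong₂ _+_ (*-identityˡ R) (sym (Σ-scale Ms (k * toℚ a) term)) ⟩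
  R + Σ Ms (λ M → k * toℚ a * term M)     ≡⟨ cong₂ _+_ (Σ-cong Ms without-S₁) (Σ-cong Ms with-S₁) ⟩
  Σ Ms (λ M → F (false ∷ M)) + Σ Ms (λ M → F (true ∷ M)) ≡⟨ sym (Σ-allVecs m F) ⟩
  Σ (allVecs (suc m)) F                   ∎
  where
  open ≡-Reasoning
  a    = monomial (S fz) x
  rest = polyGF2 (S ∘ fs) x
  k    = - (1ℚ + 1ℚ)
  Ms   = allVecs m
  term = λ M → weight M * toℚ (monomial (unionOf (S ∘ fs) M) x)
  R    = Σ Ms term
  F    = λ M → weight M * toℚ (monomial (unionOf S M) x)

  without-S₁ : ∀ M → term M ≡ F (false ∷ M)
  without-S₁ M = cong (λ U → weight M * toℚ (monomial U x)) (sym (unionOf-cons S false M))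

  with-S₁ : ∀ M → k * toℚ a * term M ≡ F (true ∷ M)
  with-S₁ M = begin
    k * toℚ a * (weight M * toℚ y)  ≡⟨ solve 4 (λ p q r s → p :* q :* (r :* s) := (p :* r) :* (q :* s))
                                               refl k (toℚ a) (weight M) (toℚ y) ⟩
    (k * weight M) * (toℚ a * toℚ y) ≡⟨ cong ((k * weight M) *_) (sym (toℚ-∧ a y)) ⟩
    (k * weight M) * toℚ (a ∧ y)     ≡⟨ cong (λ z → (k * weight M) * toℚ z) (sym (monomial-∪ (S fz) _ x)) ⟩
    (k * weight M) * toℚ (monomial (S fz ∪ unionOf (S ∘ fs) M) x)
                                     ≡⟨ cong (λ U → (k * weight M) * toℚ (monomial U x)) (sym (unionOf-cons S true M)) ⟩
    F (true ∷ M)                     ∎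
    where y = monomial (unionOf (S ∘ fs) M) x

monomialFourier : {n : ℕ} → Subset n → Subset n → ℚ
monomialFourier T U = if ⌊ U ⊆? T ⌋ then pow (- 1ℚ) ∣ U ∣ * pow ½ ∣ T ∣ else 0ℚ

-- The contribution of one coordinate to x_T(x)·(-1)^{⟨U,x⟩}: index bits s, u and value c.
coordinateTerm : Bool → Bool → Bool → ℚ
coordinateTerm s u c = toℚ (not s ∨ c) * pow (- 1ℚ) (if u ∧ c then 1 else 0)

-- Its sum over c ∈ {0,1}, the factor by which the correlation sum grows per coordinate.
coordinateSum : Bool → Bool → ℚ
coordinateSum s u = coordinateTerm s u false + coordinateTerm s u true

monomialTerm : {n : ℕ} → Subset n → Subset n → Vec Bool n → ℚ
monomialTerm T U x = toℚ (monomial T x) * pow (- 1ℚ) (dotCount U x)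

pow-if-suc : (q : ℚ) (b : Bool) (d : ℕ) →
  pow q (if b then suc d else d) ≡ pow q (if b then 1 else 0) * pow q d
pow-if-suc q false d = sym (*-identityˡ (pow q d))
pow-if-suc q true  d = cong (_* pow q d) (sym (*-identityʳ q))

monomialTerm-cons : {n : ℕ} (s u c : Bool) (T U : Subset n) (x : Vec Bool n) →
  monomialTerm (s ∷ T) (u ∷ U) (c ∷ x) ≡ coordinateTerm s u c * monomialTerm T U x
monomialTerm-cons s u c T U x = begin
  toℚ (monomial (s ∷ T) (c ∷ x)) * pow (- 1ℚ) (dotCount (u ∷ U) (c ∷ x))
    ≡⟨ cong₂ (λ p d → toℚ p * pow (- 1ℚ) d) (monomial-cons s T c x) (dotCount-cons u U c x) ⟩
  toℚ ((not s ∨ c) ∧ monomial T x) * pow (- 1ℚ) (if u ∧ c then suc (dotCount U x) else dotCount U x)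
    ≡⟨ cong₂ _*_ (toℚ-∧ (not s ∨ c) (monomial T x)) (pow-if-suc (- 1ℚ) (u ∧ c) (dotCount U x)) ⟩
  toℚ (not s ∨ c) * toℚ (monomial T x) * (pow (- 1ℚ) (if u ∧ c then 1 else 0) * pow (- 1ℚ) (dotCount U x))
    ≡⟨ solve 4 (λ a b c d → a :* b :* (c :* d) := (a :* c) :* (b :* d)) refl
         (toℚ (not s ∨ c)) (toℚ (monomial T x)) (pow (- 1ℚ) (if u ∧ c then 1 else 0)) (pow (- 1ℚ) (dotCount U x)) ⟩
  coordinateTerm s u c * monomialTerm T U x ∎
  where open ≡-Reasoning

correlation-cons : {n : ℕ} (s u : Bool) (T U : Subset n) →
  Σ (allVecs (suc n)) (monomialTerm (s ∷ T) (u ∷ U)) ≡ coordinateSum s u * Σ (allVecs n) (monomialTerm T U)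
correlation-cons {n} s u T U = begin
  Σ (allVecs (suc n)) (monomialTerm (s ∷ T) (u ∷ U))
    ≡⟨ Σ-allVecs n _ ⟩
  Σ X (λ x → monomialTerm (s ∷ T) (u ∷ U) (false ∷ x)) + Σ X (λ x → monomialTerm (s ∷ T) (u ∷ U) (true ∷ x))
    ≡⟨ cong₂ _+_ (factor false) (factor true) ⟩
  coordinateTerm s u false * G + coordinateTerm s u true * G
    ≡⟨ sym (*-distribʳ-+ G (coordinateTerm s u false) (coordinateTerm s u true)) ⟩
  coordinateSum s u * G ∎
  where
  open ≡-Reasoning
  X = allVecs n
  G = Σ X (monomialTerm T U)
  factor : ∀ c → Σ X (λ x → monomialTerm (s ∷ T) (u ∷ U) (c ∷ x)) ≡ coordinateTerm s u c * G
  factor c = trans (Σ-cong X (monomialTerm-cons s u c T U)) (Σ-scale X (coordinateTerm s u c) (monomialTerm T U))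

if-scaled : (b : Bool) {A B : ℚ} (c : ℚ) → A ≡ c * B → (if b then A else 0ℚ) ≡ c * (if b then B else 0ℚ)
if-scaled false c _  = sym (*-zeroʳ c)
if-scaled true  c eq = eq

subset-guard-cons : {n : ℕ} (s u : Bool) (T U : Subset n) → not u ∨ s ≡ true →
  monomialFourier (s ∷ T) (u ∷ U)
    ≡ (if ⌊ U ⊆? T ⌋ then pow (- 1ℚ) ∣ u ∷ U ∣ * pow ½ ∣ s ∷ T ∣ else 0ℚ)
subset-guard-cons s    false T U _ =
  cong (λ b → if b then pow (- 1ℚ) ∣ false ∷ U ∣ * pow ½ ∣ s ∷ T ∣ else 0ℚ) (⌊⌋-map′ _ _ (U ⊆? T))
subset-guard-cons true true  T U _ =
  cong (λ b → if b then pow (- 1ℚ) ∣ true ∷ U ∣ * pow ½ ∣ true ∷ T ∣ else 0ℚ) (⌊⌋-map′ _ _ (U ⊆? T))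

-- The closed form obeys the same one-coordinate recursion, with the factor
-- 2^{-1} coming from the normalisation of the transform.  The constant
-- ½ · coordinateSum s u evaluates to 1, 0, ½, -½ for (s,u) = (0,0), (0,1),
-- (1,0), (1,1), matching the change of the closed form in each case.
monomialFourier-cons : {n : ℕ} (s u : Bool) (T U : Subset n) →
  monomialFourier (s ∷ T) (u ∷ U) ≡ (½ * coordinateSum s u) * monomialFourier T U
monomialFourier-cons false false T U =
  trans (subset-guard-cons false false T U refl)
        (if-scaled ⌊ U ⊆? T ⌋ (½ * coordinateSum false false) (sym (*-identityˡ (pow (- 1ℚ) ∣ U ∣ * pow ½ ∣ T ∣))))
monomialFourier-cons false true  T U = sym (*-zeroˡ (monomialFourier T U))
monomialFourier-cons true  false T U =
  trans (subset-guard-cons true false T U refl)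
        (if-scaled ⌊ U ⊆? T ⌋ (½ * coordinateSum true false)
           (solve 3 (λ h a b → a :* (h :* b) := h :* (a :* b)) refl ½ (pow (- 1ℚ) ∣ U ∣) (pow ½ ∣ T ∣)))
monomialFourier-cons true  true  T U =
  trans (subset-guard-cons true true T U refl)
        (if-scaled ⌊ U ⊆? T ⌋ (½ * coordinateSum true true)
           (solve 4 (λ m h a b → (m :* a) :* (h :* b) := (m :* h) :* (a :* b)) refl
                    (- 1ℚ) ½ (pow (- 1ℚ) ∣ U ∣) (pow ½ ∣ T ∣)))

fourier-monomial : (n : ℕ) (T U : Subset n) → fourier (toℚ ∘ monomial T) U ≡ monomialFourier T U
fourier-monomial zero    []      []      = refl
fourier-monomial (suc n) (s ∷ T) (u ∷ U) = begin
  ½ * pow ½ n * Σ (allVecs (suc n)) (monomialTerm (s ∷ T) (u ∷ U))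
    ≡⟨ cong (½ * pow ½ n *_) (correlation-cons s u T U) ⟩
  ½ * pow ½ n * (coordinateSum s u * Σ (allVecs n) (monomialTerm T U))
    ≡⟨ solve 4 (λ h p w g → h :* p :* (w :* g) := (h :* w) :* (p :* g)) refl
               ½ (pow ½ n) (coordinateSum s u) (Σ (allVecs n) (monomialTerm T U)) ⟩
  (½ * coordinateSum s u) * fourier (toℚ ∘ monomial T) U
    ≡⟨ cong ((½ * coordinateSum s u) *_) (fourier-monomial n T U) ⟩
  (½ * coordinateSum s u) * monomialFourier T U
    ≡⟨ sym (monomialFourier-cons s u T U) ⟩
  monomialFourier (s ∷ T) (u ∷ U) ∎
  where open ≡-Reasoning

fourier-cong : {n : ℕ} {h h′ : Vec Bool n → ℚ} → (∀ x → h x ≡ h′ x) → (U : Subset n) →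
  fourier h U ≡ fourier h′ U
fourier-cong {n} eq U = cong (pow ½ n *_) (Σ-cong (allVecs n) (λ x → cong (_* pow (- 1ℚ) (dotCount U x)) (eq x)))

fourier-linear : {n : ℕ} {A : Set} (Ms : List A) (c : A → ℚ) (g : A → Vec Bool n → ℚ) (U : Subset n) →
  fourier (λ x → Σ Ms (λ M → c M * g M x)) U ≡ Σ Ms (λ M → c M * fourier (g M) U)
fourier-linear {n} Ms c g U = begin
  pow ½ n * Σ X (λ x → Σ Ms (λ M → c M * g M x) * χ x)
    ≡⟨ cong (pow ½ n *_) (Σ-cong X (λ x → Σ-scaleʳ Ms (λ M → c M * g M x) (χ x))) ⟩
  pow ½ n * Σ X (λ x → Σ Ms (λ M → c M * g M x * χ x))
    ≡⟨ cong (pow ½ n *_) (Σ-swap X Ms (λ x M → c M * g M x * χ x)) ⟩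
  pow ½ n * Σ Ms (λ M → Σ X (λ x → c M * g M x * χ x))
    ≡⟨ cong (pow ½ n *_) (Σ-cong Ms pull-out) ⟩
  pow ½ n * Σ Ms (λ M → c M * Σ X (λ x → g M x * χ x))
    ≡⟨ sym (Σ-scale Ms (pow ½ n) _) ⟩
  Σ Ms (λ M → pow ½ n * (c M * Σ X (λ x → g M x * χ x)))
    ≡⟨ Σ-cong Ms (λ M → solve 3 (λ a b c → a :* (b :* c) := b :* (a :* c)) refl
                                (pow ½ n) (c M) (Σ X (λ x → g M x * χ x))) ⟩
  Σ Ms (λ M → c M * fourier (g M) U) ∎
  where
  open ≡-Reasoning
  X = allVecs n
  χ = λ x → pow (- 1ℚ) (dotCount U x)
  pull-out : ∀ M → Σ X (λ x → c M * g M x * χ x) ≡ c M * Σ X (λ x → g M x * χ x)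
  pull-out M = trans (Σ-cong X (λ x → *-assoc (c M) (g M x) (χ x))) (Σ-scale X (c M) (λ x → g M x * χ x))

≟-cons : {n : ℕ} (b c : Bool) (V T : Vec Bool n) →
  ⌊ ≡-dec BoolP._≟_ (b ∷ V) (c ∷ T) ⌋ ≡ ⌊ b BoolP.≟ c ⌋ ∧ ⌊ ≡-dec BoolP._≟_ V T ⌋
≟-cons b c V T = trans (isYes≗does (≡-dec BoolP._≟_ (b ∷ V) (c ∷ T)))
  (sym (cong₂ _∧_ (isYes≗does (b BoolP.≟ c)) (isYes≗does (≡-dec BoolP._≟_ V T))))

Σ-delta : (n : ℕ) (V : Vec Bool n) (F : Vec Bool n → ℚ) →
  Σ (allVecs n) (λ T → if ⌊ ≡-dec BoolP._≟_ V T ⌋ then F T else 0ℚ) ≡ F V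
Σ-delta zero    []      F = +-identityʳ (F [])
Σ-delta (suc n) (b ∷ V) F = begin
  Σ (allVecs (suc n)) (δ (b ∷ V) F)
    ≡⟨ Σ-allVecs n (δ (b ∷ V) F) ⟩
  Σ X (λ T → δ (b ∷ V) F (false ∷ T)) + Σ X (λ T → δ (b ∷ V) F (true ∷ T))
    ≡⟨ cong₂ _+_ (first-coordinate false) (first-coordinate true) ⟩
  (if ⌊ b BoolP.≟ false ⌋ then F (false ∷ V) else 0ℚ) + (if ⌊ b BoolP.≟ true ⌋ then F (true ∷ V) else 0ℚ)
    ≡⟨ pick b ⟩
  F (b ∷ V) ∎
  where
  open ≡-Reasoning
  X = allVecs n
  δ : {k : ℕ} → Vec Bool k → (Vec Bool k → ℚ) → Vec Bool k → ℚ
  δ V F T = if ⌊ ≡-dec BoolP._≟_ V T ⌋ then F T else 0ℚ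

  -- Only the half of the cube whose first coordinate agrees with b contributes.
  first-coordinate : ∀ c → Σ X (λ T → δ (b ∷ V) F (c ∷ T)) ≡ (if ⌊ b BoolP.≟ c ⌋ then F (c ∷ V) else 0ℚ)
  first-coordinate c = trans (Σ-cong X (λ T → cong (λ e → if e then F (c ∷ T) else 0ℚ) (≟-cons b c V T)))
                             (guarded ⌊ b BoolP.≟ c ⌋)
    where
    guarded : ∀ a → Σ X (λ T → if a ∧ ⌊ ≡-dec BoolP._≟_ V T ⌋ then F (c ∷ T) else 0ℚ)
                  ≡ (if a then F (c ∷ V) else 0ℚ)
    guarded false = Σ-zero X
    guarded true  = Σ-delta n V (λ T → F (c ∷ T))

  pick : ∀ b → (if ⌊ b BoolP.≟ false ⌋ then F (false ∷ V) else 0ℚ) + (if ⌊ b BoolP.≟ true ⌋ then F (true ∷ V) else 0ℚ)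
             ≡ F (b ∷ V)
  pick false = +-identityʳ (F (false ∷ V))
  pick true  = +-identityˡ (F (true ∷ V))

if-if : (a b : Bool) (v : ℚ) → (if a then (if b then v else 0ℚ) else 0ℚ) ≡ (if b then (if a then v else 0ℚ) else 0ℚ)
if-if false false v = refl
if-if false true  v = refl
if-if true  false v = refl
if-if true  true  v = refl

-- Each family M contributes to w_f(T) only for T = ⋃_{i∈M} S_i, so
-- Σ_{T ⊇ U} w_f(T) = Σ_{M : ⋃M ⊇ U} (-2)^{|M|} 2^{-|⋃M|}.
sumSupersets-by-family : {n m : ℕ} (S : Fin m → Subset n) (U : Subset n) →
  sumSupersets S U ≡
  Σ (allVecs m) (λ M → if ⌊ U ⊆? unionOf S M ⌋ then weight M * pow ½ ∣ unionOf S M ∣ else 0ℚ)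
sumSupersets-by-family {n} {m} S U = begin
  Σ X (λ T → if ⌊ U ⊆? T ⌋ then Σ Ms (λ M → term M T) else 0ℚ)
    ≡⟨ Σ-cong X (λ T → if-Σ Ms ⌊ U ⊆? T ⌋ (λ M → term M T)) ⟩
  Σ X (λ T → Σ Ms (λ M → if ⌊ U ⊆? T ⌋ then term M T else 0ℚ))
    ≡⟨ Σ-swap X Ms (λ T M → if ⌊ U ⊆? T ⌋ then term M T else 0ℚ) ⟩
  Σ Ms (λ M → Σ X (λ T → if ⌊ U ⊆? T ⌋ then term M T else 0ℚ))
    ≡⟨ Σ-cong Ms (λ M → Σ-cong X (λ T → if-if ⌊ U ⊆? T ⌋ (union≟ M T) (weight M * pow ½ ∣ T ∣))) ⟩
  Σ Ms (λ M → Σ X (λ T → if union≟ M T then (if ⌊ U ⊆? T ⌋ then weight M * pow ½ ∣ T ∣ else 0ℚ) else 0ℚ))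
    ≡⟨ Σ-cong Ms (λ M → Σ-delta n (unionOf S M) (λ T → if ⌊ U ⊆? T ⌋ then weight M * pow ½ ∣ T ∣ else 0ℚ)) ⟩
  Σ Ms (λ M → if ⌊ U ⊆? unionOf S M ⌋ then weight M * pow ½ ∣ unionOf S M ∣ else 0ℚ) ∎
  where
  open ≡-Reasoning
  X  = allVecs n
  Ms = allVecs m
  union≟ : Subset m → Subset n → Bool
  union≟ M T = ⌊ ≡-dec BoolP._≟_ (unionOf S M) T ⌋
  term : Subset m → Subset n → ℚ
  term M T = if union≟ M T then weight M * pow ½ ∣ T ∣ else 0ℚ

weighted-monomialFourier : {n m : ℕ} (M : Subset m) (T U : Subset n) →
  weight M * monomialFourier T U ≡ pow (- 1ℚ) ∣ U ∣ * (if ⌊ U ⊆? T ⌋ then weight M * pow ½ ∣ T ∣ else 0ℚ)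
weighted-monomialFourier M T U with ⌊ U ⊆? T ⌋
... | false = trans (*-zeroʳ (weight M)) (sym (*-zeroʳ (pow (- 1ℚ) ∣ U ∣)))
... | true  = solve 3 (λ c p h → c :* (p :* h) := p :* (c :* h)) refl (weight M) (pow (- 1ℚ) ∣ U ∣) (pow ½ ∣ T ∣)

lemma4p1 : (n m : ℕ) (S : Fin m → Subset n) → Injective _≡_ _≡_ S →
    (U : Subset n) →
    fourier (pm (polyGF2 S)) U ≡ pow (- 1ℚ) ∣ U ∣ * sumSupersets S U
lemma4p1 n m S _ U = begin
  fourier (pm (polyGF2 S)) U
    ≡⟨ fourier-cong (sign-expansion m S) U ⟩
  fourier (λ x → Σ Ms (λ M → weight M * toℚ (monomial (unionOf S M) x))) U
    ≡⟨ fourier-linear Ms weight (λ M → toℚ ∘ monomial (unionOf S M)) U ⟩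
  Σ Ms (λ M → weight M * fourier (toℚ ∘ monomial (unionOf S M)) U)
    ≡⟨ Σ-cong Ms (λ M → cong (weight M *_) (fourier-monomial n (unionOf S M) U)) ⟩
  Σ Ms (λ M → weight M * monomialFourier (unionOf S M) U)
    ≡⟨ Σ-cong Ms (λ M → weighted-monomialFourier M (unionOf S M) U) ⟩
  Σ Ms (λ M → pow (- 1ℚ) ∣ U ∣ * (if ⌊ U ⊆? unionOf S M ⌋ then weight M * pow ½ ∣ unionOf S M ∣ else 0ℚ))
    ≡⟨ Σ-scale Ms (pow (- 1ℚ) ∣ U ∣) _ ⟩
  pow (- 1ℚ) ∣ U ∣ * Σ Ms (λ M → if ⌊ U ⊆? unionOf S M ⌋ then weight M * pow ½ ∣ unionOf S M ∣ else 0ℚ)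
    ≡⟨ cong (pow (- 1ℚ) ∣ U ∣ *_) (sym (sumSupersets-by-family S U)) ⟩
  pow (- 1ℚ) ∣ U ∣ * sumSupersets S U ∎
  where
  open ≡-Reasoning
  Ms = allVecs m
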